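{- Let $k\ge1$, $n\ge1$, $m=kn+1$, $D\in\mathcal D_{m,n}$, and let $T(D)$ have first row entries $t_1,\dots,t_n$ and bottom row entries $b_1,\dots,b_n$. Then $$\mathrm{coarea}(D)=\sum_{i=1}^n t_i-\binom{n+1}{2},\qquad \mathrm{area}(D)=\sum_{i=1}^n b_i-(k+1)\binom{n+1}{2}.$$
   Context: $\mathcal D_{m,n}$ (coprime $m,n$) is the set of lattice paths from $(0,0)$ to $(m,n)$ with unit North and East steps staying weakly above the segment from $(0,0)$ to $(m,n)$; $\mathrm{SW}(D)$ is its step word ($S$ for North, $W$ for East). $\mathrm{area}(D)$ is the number of unit cells between $D$ and the main diagonal not cut by the diagonal; for $m=kn+1$ its maximum is $k\binom n2$ and $\mathrm{coarea}(D):=k\binom n2-\mathrm{area}(D)$. $T(D)$ is the array with $k+1$ rows and $n$ columns produced by the filling algorithm: place $1$ at the top of column 1; for $i=2,\dots,m+n-1$, if the $i$-th letter of $\mathrm{SW}(D)$ is $S$ place $i$ at the top of the leftmost empty column, and if $W$ place $i$ immediately below the smallest active entry (lowest in its column and not in row $k+1$). The bottom row is row $k+1$. -}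

module Defs where

open import Data.Nat using (ℕ; zero; suc; _+_; _*_; _∸_; _≤_; _<_; _≤?_; _<ᵇ_)
open import Data.Nat.Combinatorics using (_C_)
open import Data.Bool using (Bool; true; false; if_then_else_; _∧_)
open import Data.List using (List; []; _∷_; map; sum; length; replicate; take; drop; reverse; upTo; filter)
open import Data.Maybe using (Maybe; just; nothing)
open import Data.Product using (_×_; _,_)
open import Data.Integer using (ℤ; +_; _-_)
open import Relation.Binary.PropositionalEquality using (_≡_)
open import Relation.Nullary.Decidable using (⌊_⌋)

-- Lattice paths.  A path is its list of unit steps; `north` corresponds
-- to the letter S of SW(D), `east` to the letter W of SW(D).

data Step : Set where
  north east : Step

endpoint : List Step → ℕ × ℕ
endpoint [] = 0 , 0
endpoint (north ∷ w) with endpoint w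
... | x , y = x , suc y
endpoint (east ∷ w) with endpoint w
... | x , y = suc x , y

-- Every lattice point (x , y) visited from the current point (x , y)
-- onward lies weakly above the line from (0,0) to (m,n): n*x ≤ m*y.
AboveFrom : (m n x y : ℕ) → List Step → Set
AboveFrom m n x y [] = n * x ≤ m * y
AboveFrom m n x y (north ∷ w) = (n * x ≤ m * y) × AboveFrom m n x (suc y) w
AboveFrom m n x y (east ∷ w) = (n * x ≤ m * y) × AboveFrom m n (suc x) y w

IsDyck : (m n : ℕ) → List Step → Set
IsDyck m n w = endpoint w ≡ (m , n) × AboveFrom m n 0 0 w

-- The cell with lower-left corner (x' , y) lies between D and the
-- diagonal and is not cut by the diagonal iff it lies to the right of
-- the north step of D in row y (which is at abscissa x), i.e. x ≤ x',
-- and its lower-right corner (x'+1 , y) is weakly above the diagonal,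
-- i.e. n*(x'+1) ≤ m*y.

cellsInRow : (m n x y : ℕ) → ℕ
cellsInRow m n x y =
  length (filter (λ x' → (x ≤? x') Relation.Nullary.Decidable.×-dec (n * suc x' ≤? m * y)) (upTo m))

areaFrom : (m n x y : ℕ) → List Step → ℕ
areaFrom m n x y [] = 0
areaFrom m n x y (north ∷ w) = cellsInRow m n x y + areaFrom m n x (suc y) w
areaFrom m n x y (east ∷ w) = areaFrom m n (suc x) y w

area : (m n : ℕ) → List Step → ℕ
area m n w = areaFrom m n 0 0 w

coarea : (k n : ℕ) → List Step → ℤ
coarea k n w = + (k * (n C 2)) - + area (k * n + 1) n w

-- Filling algorithm.  During the algorithm each column is stored as a
-- list of its entries from BOTTOM to TOP (head = lowest entry).

placeTop : ℕ → List (List ℕ) → List (List ℕ)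
placeTop i [] = []
placeTop i ([] ∷ cs) = (i ∷ []) ∷ cs
placeTop i ((x ∷ c) ∷ cs) = (x ∷ c) ∷ placeTop i cs

-- a column (with k+1 rows) is active if nonempty and its lowest entry is
-- not in row k+1, i.e. it has at most k entries
isActive : ℕ → List ℕ → Bool
isActive k [] = false
isActive k (x ∷ c) = length (x ∷ c) <ᵇ suc k

activeEntries : ℕ → List (List ℕ) → List ℕ
activeEntries k [] = []
activeEntries k ([] ∷ cs) = activeEntries k cs
activeEntries k ((x ∷ c) ∷ cs) =
  if isActive k (x ∷ c) then x ∷ activeEntries k cs else activeEntries k cs

minimumMaybe : List ℕ → Maybe ℕ
minimumMaybe [] = nothing
minimumMaybe (x ∷ xs) with minimumMaybe xs
... | nothing = just x
... | just y = just (if x <ᵇ y then x else y)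

insertBelow : ℕ → ℕ → ℕ → List (List ℕ) → List (List ℕ)
insertBelow k v i [] = []
insertBelow k v i ([] ∷ cs) = [] ∷ insertBelow k v i cs
insertBelow k v i ((x ∷ c) ∷ cs) =
  if isActive k (x ∷ c) ∧ ⌊ x Data.Nat.≟ v ⌋
  then (i ∷ x ∷ c) ∷ cs
  else (x ∷ c) ∷ insertBelow k v i cs

fillStep : ℕ → ℕ → List (List ℕ) → Step → List (List ℕ)
fillStep k i cs north = placeTop i cs
fillStep k i cs east with minimumMaybe (activeEntries k cs)
... | nothing = cs
... | just v = insertBelow k v i cs

fillRun : ℕ → ℕ → List (List ℕ) → List Step → List (List ℕ)
fillRun k i cs [] = cs
fillRun k i cs (s ∷ w) = fillRun k (suc i) (fillStep k i cs s) w

-- T(D) for D ∈ 𝒟_{kn+1,n}, returned as its list of n columns, each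
-- column listed from TOP (row 1) to BOTTOM (row k+1).
-- 1 is placed at the top of column 1, then letters i = 2 , … , m+n-1
-- of SW(D) are processed (m = kn+1).
fillT : (k n : ℕ) → List Step → List (List ℕ)
fillT k n w =
  map reverse
    (fillRun k 2 ((1 ∷ []) ∷ replicate (n ∸ 1) [])
       (take ((k * n + 1) + n ∸ 2) (drop 1 w)))

-- entry r (0-indexed from the top) of a column (0 if absent)
entryAt : ℕ → List ℕ → ℕ
entryAt r [] = 0
entryAt zero (x ∷ c) = x
entryAt (suc r) (x ∷ c) = entryAt r c

rowOf : ℕ → List (List ℕ) → List ℕ
rowOf r cols = map (entryAt r) cols

topRow : (k n : ℕ) → List Step → List ℕ
topRow k n w = rowOf 0 (fillT k n w)

bottomRow : (k n : ℕ) → List Step → List ℕ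
bottomRow k n w = rowOf k (fillT k n w)

module Submission where

-- A north step at (x , y) puts its index x + y + 1 at the top of a new column, while the cells of
-- row y to the right of D number k y − x; so Σ tᵢ + area(D) = Σ_{y<n} (1 + (k + 1) y), which is
-- the coarea formula.  For the bottom row, the active columns are served cyclically in the order
-- of their lowest entries and their total deficit is always k y − x.  The potential Φ, the sum of
-- the bottom entries the active columns would receive if only east steps followed, grows by the
-- area of row y plus (k + 1)(y + 1) at each north step, and an east step completing a column
-- moves that column's bottom entry from Φ into the bottom row.  Φ starts at k + 1 and ends at 0.

open import Defs
open import Data.Nat using (ℕ; zero; suc; _+_; _*_; _∸_; _≤_; _<_; _⊓_; _<?_; _≤?_; z≤n; s≤s; _<ᵇ_; _≟_)
open import Data.Nat.Properties
open import Data.Nat.Combinatorics using (_C_; nCk+nC[k+1]≡[n+1]C[k+1]; nC1≡n)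
open import Data.Nat.ListAction using (sum)
open import Data.Nat.ListAction.Properties using (sum-↭)
open import Data.Nat.Tactic.RingSolver using (solve-∀)
open import Data.List
  using (List; []; _∷_; _++_; [_]; length; map; concatMap; reverse; filter; upTo; take; replicate; initLast; _∷ʳ′_)
open import Data.List.Properties
  using (map-cong; map-cong-local; unfold-reverse; length-reverse; length-++; upTo-∷ʳ; filter-++; filter-accept; filter-reject)
open import Data.List.Membership.Propositional using (_∈_)
open import Data.List.Relation.Unary.All using (All; []; _∷_)
import Data.List.Relation.Unary.All as All
import Data.List.Relation.Unary.All.Properties as All
open import Data.List.Relation.Unary.Any using (Any; here; there)
import Data.List.Relation.Unary.Any.Properties as Any
open import Data.List.Relation.Unary.AllPairs using (AllPairs; []; _∷_)
open import Data.List.Relation.Binary.Permutation.Propositional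
  using (_↭_; ↭-refl; ↭-reflexive; ↭-sym; ↭-trans; ↭⇒↭ₛ)
open import Data.List.Relation.Binary.Permutation.Propositional.Properties using (map⁺; All-resp-↭; shift; ++⁺ˡ)
import Data.List.Relation.Binary.Permutation.Setoid.Properties as SetoidPermutation
open import Data.Product using (_×_; _,_; proj₁; proj₂; ∃)
open import Data.Bool using (true; false; if_then_else_; _∧_; T)
open import Data.Maybe using (just; nothing)
open import Data.Empty using (⊥; ⊥-elim)
open import Function using (_∘_)
open import Relation.Nullary using (yes; no; ¬_)
open import Relation.Nullary.Decidable using (⌊_⌋)
import Relation.Unary as U
open import Relation.Binary.PropositionalEquality hiding ([_])
open import Algebra.Properties.CommutativeSemigroup +-commutativeSemigroup
  using (interchange; x∙yz≈y∙xz; xy∙z≈y∙xz)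

sum-map-+ : ∀ {A : Set} (f g : A → ℕ) xs →
  sum (map (λ a → f a + g a) xs) ≡ sum (map f xs) + sum (map g xs)
sum-map-+ f g [] = refl
sum-map-+ f g (a ∷ xs) =
  trans (cong ((f a + g a) +_) (sum-map-+ f g xs)) (interchange (f a) (g a) (sum (map f xs)) (sum (map g xs)))

sum-map-suc : ∀ {A : Set} (f : A → ℕ) xs → sum (map (λ a → suc (f a)) xs) ≡ length xs + sum (map f xs)
sum-map-suc f [] = refl
sum-map-suc f (a ∷ xs) =
  cong suc (trans (cong (f a +_) (sum-map-suc f xs)) (x∙yz≈y∙xz (f a) (length xs) (sum (map f xs))))

sum-map-const : ∀ {A : Set} c (xs : List A) → sum (map (λ _ → c) xs) ≡ length xs * c
sum-map-const c [] = refl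
sum-map-const c (a ∷ xs) = cong (c +_) (sum-map-const c xs)

sum-map-cong-local : ∀ {A : Set} {f g : A → ℕ} {xs} → All (λ a → f a ≡ g a) xs → sum (map f xs) ≡ sum (map g xs)
sum-map-cong-local eqs = cong sum (map-cong-local eqs)

sum-map-↭ : ∀ {A : Set} (f : A → ℕ) {xs ys} → xs ↭ ys → sum (map f xs) ≡ sum (map f ys)
sum-map-↭ f p = sum-↭ (map⁺ f p)

length+sum-map-pred : ∀ {A : Set} (f : A → ℕ) xs → All (λ a → 1 ≤ f a) xs →
  length xs + sum (map (λ a → f a ∸ 1) xs) ≡ sum (map f xs)
length+sum-map-pred f xs positive =
  trans (sym (sum-map-suc (λ a → f a ∸ 1) xs)) (sum-map-cong-local (All.map suc-∸1 positive))
  where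
  suc-∸1 : ∀ {d} → 1 ≤ d → suc (d ∸ 1) ≡ d
  suc-∸1 (s≤s _) = refl

take-length-++ : ∀ {A : Set} (xs ys : List A) → take (length xs) (xs ++ ys) ≡ xs
take-length-++ [] ys = refl
take-length-++ (x ∷ xs) ys = cong (x ∷_) (take-length-++ xs ys)

-- The potential of a queue of active columns

-- An active column, recorded by its lowest entry and its deficit (the number of entries it lacks).
Slot : Set
Slot = ℕ × ℕ

entry deficit : Slot → ℕ
entry = proj₁
deficit = proj₂

deficitSum : List Slot → ℕ
deficitSum A = sum (map deficit A)

Distinct : List Slot → Set
Distinct = AllPairs (λ a b → entry a ≢ entry b)

Distinct-resp-↭ : ∀ {A B} → A ↭ B → Distinct A → Distinct B
Distinct-resp-↭ p = SetoidPermutation.AllPairs-resp-↭ (setoid Slot)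
  (λ ne eq → ne (sym eq)) ((λ { refl r → r }) , (λ { refl r → r })) (↭⇒↭ₛ p)

-- If only east steps followed, the active columns would be served cyclically in increasing order
-- of their lowest entries, and column b would be served `delay b a` times before column a
-- receives its last entry.  So `t + waitOn A a` is the index of a's future bottom entry when t is
-- the index of the next letter, and Φ t A is the sum of these predicted bottom entries.
delay : Slot → Slot → ℕ
delay (v′ , d′) (v , d) with v′ <? v
... | yes _ = d′ ⊓ d
... | no  _ = d′ ⊓ (d ∸ 1)

delay-< : ∀ {v′ v} d′ d → v′ < v → delay (v′ , d′) (v , d) ≡ d′ ⊓ d
delay-< {v′} {v} d′ d v′<v with v′ <? v
... | yes _ = refl
... | no v′≮v = ⊥-elim (v′≮v v′<v)

delay-≥ : ∀ {v′ v} d′ d → v ≤ v′ → delay (v′ , d′) (v , d) ≡ d′ ⊓ (d ∸ 1)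
delay-≥ {v′} {v} d′ d v≤v′ with v′ <? v
... | yes v′<v = ⊥-elim (<⇒≱ v′<v v≤v′)
... | no _ = refl

waitOn : List Slot → Slot → ℕ
waitOn A a = sum (map (λ b → delay b a) A)

Φ : ℕ → List Slot → ℕ
Φ t A = sum (map (λ a → t + waitOn A a) A)

Φ-suc : ∀ t A → Φ (suc t) A ≡ length A + Φ t A
Φ-suc t A = sum-map-suc (λ a → t + waitOn A a) A

Φ-↭ : ∀ t {A B} → A ↭ B → Φ t A ≡ Φ t B
Φ-↭ t {A} {B} p = trans (cong sum (map-cong (λ a → cong (t +_) (sum-map-↭ (λ b → delay b a) p)) A))
                         (sum-map-↭ (λ a → t + waitOn B a) p)

Φ-∷ : ∀ t e X {self waits delays} → delay e e ≡ self → waitOn X e ≡ waits → sum (map (delay e) X) ≡ delays →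
  Φ t (e ∷ X) ≡ t + self + waits + (delays + Φ t X)
Φ-∷ t e X refl refl refl = cong₂ _+_ (sym (+-assoc t (delay e e) (waitOn X e)))
  (trans (cong sum (map-cong (λ a → x∙yz≈y∙xz t (delay e a) (waitOn X a)) X))
         (sum-map-+ (delay e) (λ a → t + waitOn X a) X))

Φ-enqueue : ∀ c t X → All (λ b → entry b < t) X → All (λ b → 1 ≤ deficit b × deficit b ≤ suc c) X →
  Φ (suc t) ((t , suc c) ∷ X) ≡ Φ t X + (2 * deficitSum X + t + suc c)
Φ-enqueue c t X earlier bounded = begin
    Φ (suc t) (e ∷ X)
  ≡⟨ Φ-∷ (suc t) e X self waits delays ⟩
    suc t + c + D + (R + Φ (suc t) X)
  ≡⟨ cong₂ (λ d p → suc t + c + d + (R + p)) (sym L+R≡D) (Φ-suc t X) ⟩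
    suc t + c + (L + R) + (R + (L + Φ t X))
  ≡⟨ rearrange t c L R (Φ t X) ⟩
    Φ t X + (2 * (L + R) + t + suc c)
  ≡⟨ cong (λ d → Φ t X + (2 * d + t + suc c)) L+R≡D ⟩
    Φ t X + (2 * D + t + suc c)
  ∎
  where
  open ≡-Reasoning
  e = (t , suc c)
  D = deficitSum X
  L = length X
  R = sum (map (λ b → deficit b ∸ 1) X)
  L+R≡D : L + R ≡ D
  L+R≡D = length+sum-map-pred deficit X (All.map proj₁ bounded)
  self : delay e e ≡ c
  self = trans (delay-≥ {t} {t} (suc c) (suc c) ≤-refl) (m≥n⇒m⊓n≡n (n≤1+n c))
  waits : waitOn X e ≡ D
  waits = sum-map-cong-local (All.zipWith (λ { {_ , d} (lt , (_ , le)) →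
    trans (delay-< d (suc c) lt) (m≤n⇒m⊓n≡m le) }) (earlier , bounded))
  delays : sum (map (delay e) X) ≡ R
  delays = sum-map-cong-local (All.zipWith (λ { {_ , d} (lt , (_ , le)) →
    trans (delay-≥ (suc c) d (<⇒≤ lt)) (m≥n⇒m⊓n≡n (≤-trans (m∸n≤m d 1) le)) }) (earlier , bounded))
  rearrange : ∀ t c L R P → suc t + c + (L + R) + (R + (L + P)) ≡ P + (2 * (L + R) + t + suc c)
  rearrange = solve-∀

Φ-retire : ∀ t v X → All (λ b → v < entry b) X → All (λ b → 1 ≤ deficit b) X →
  Φ t ((v , 1) ∷ X) ≡ Φ (suc t) X + t
Φ-retire t v X later positive = begin
    Φ t (e ∷ X)
  ≡⟨ Φ-∷ t e X (delay-≥ {v} {v} 1 1 ≤-refl) waits delays ⟩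
    t + 0 + length X * 0 + (length X * 1 + Φ t X)
  ≡⟨ rearrange t (length X) (Φ t X) ⟩
    length X + Φ t X + t
  ≡⟨ cong (_+ t) (Φ-suc t X) ⟨
    Φ (suc t) X + t
  ∎
  where
  open ≡-Reasoning
  e = (v , 1)
  waits : waitOn X e ≡ length X * 0
  waits = trans (sum-map-cong-local (All.map (λ { {_ , d} lt → trans (delay-≥ d 1 (<⇒≤ lt)) (⊓-zeroʳ d) }) later))
                (sum-map-const 0 X)
  delays : sum (map (delay e) X) ≡ length X * 1
  delays = trans (sum-map-cong-local (All.zipWith (λ { {_ , d} (lt , pos) → trans (delay-< 1 d lt) (m≤n⇒m⊓n≡m pos) })
                   (later , positive)))
                 (sum-map-const 1 X)
  rearrange : ∀ t L P → t + 0 + L * 0 + (L * 1 + P) ≡ L + P + t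
  rearrange = solve-∀

Φ-requeue : ∀ t v d X → All (λ b → v < entry b × entry b < t) X → All (λ b → 1 ≤ deficit b) X →
  Φ t ((v , suc (suc d)) ∷ X) ≡ Φ (suc t) ((t , suc d) ∷ X)
Φ-requeue t v d X between positive = begin
    Φ t (e ∷ X)
  ≡⟨ Φ-∷ t e X self waits delays ⟩
    t + suc d + W + (L + R + Φ t X)
  ≡⟨ rearrange t d W L R (Φ t X) ⟩
    suc t + d + W + (R + (L + Φ t X))
  ≡⟨ cong (λ p → suc t + d + W + (R + p)) (Φ-suc t X) ⟨
    suc t + d + W + (R + Φ (suc t) X)
  ≡⟨ Φ-∷ (suc t) e′ X self′ waits′ delays′ ⟨
    Φ (suc t) (e′ ∷ X)
  ∎
  where
  open ≡-Reasoning
  e = (v , suc (suc d))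
  e′ = (t , suc d)
  L = length X
  W = sum (map (λ b → deficit b ⊓ suc d) X)
  R = sum (map (λ a → suc d ⊓ (deficit a ∸ 1)) X)
  self : delay e e ≡ suc d
  self = trans (delay-≥ {v} {v} (suc (suc d)) (suc (suc d)) ≤-refl) (m≥n⇒m⊓n≡n (n≤1+n (suc d)))
  self′ : delay e′ e′ ≡ d
  self′ = trans (delay-≥ {t} {t} (suc d) (suc d) ≤-refl) (m≥n⇒m⊓n≡n (n≤1+n d))
  waits : waitOn X e ≡ W
  waits = sum-map-cong-local (All.map (λ { {_ , d′} (lt , _) → delay-≥ d′ _ (<⇒≤ lt) }) between)
  waits′ : waitOn X e′ ≡ W
  waits′ = sum-map-cong-local (All.map (λ { {_ , d′} (_ , lt) → delay-< d′ _ lt }) between)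
  delays : sum (map (delay e) X) ≡ L + R
  delays = trans (sum-map-cong-local (All.zipWith (λ { {_ , suc d′} ((lt , _) , _) → delay-< _ (suc d′) lt
                                                     ; {_ , zero} (_ , ()) })
                   (between , positive)))
                 (sum-map-suc (λ a → suc d ⊓ (deficit a ∸ 1)) X)
  delays′ : sum (map (delay e′) X) ≡ R
  delays′ = sum-map-cong-local (All.map (λ { {_ , d′} (_ , lt) → delay-≥ _ d′ (<⇒≤ lt) }) between)
  rearrange : ∀ t d W L R P → t + suc d + W + (L + R + P) ≡ suc t + d + W + (R + (L + P))
  rearrange = solve-∀

-- Columns and the filling algorithm

entryAt-∷ʳ-< : ∀ r xs i → r < length xs → entryAt r (xs ++ [ i ]) ≡ entryAt r xs
entryAt-∷ʳ-< zero (x ∷ xs) i _ = refl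
entryAt-∷ʳ-< (suc r) (x ∷ xs) i (s≤s r<n) = entryAt-∷ʳ-< r xs i r<n

entryAt-∷ʳ-length : ∀ xs i → entryAt (length xs) (xs ++ [ i ]) ≡ i
entryAt-∷ʳ-length [] i = refl
entryAt-∷ʳ-length (x ∷ xs) i = entryAt-∷ʳ-length xs i

entryAt-≥length : ∀ r xs → length xs ≤ r → entryAt r xs ≡ 0
entryAt-≥length r [] _ = refl
entryAt-≥length (suc r) (x ∷ xs) (s≤s n≤r) = entryAt-≥length r xs n≤r

entryAt-reverse-∷-< : ∀ r i c → r < length c → entryAt r (reverse (i ∷ c)) ≡ entryAt r (reverse c)
entryAt-reverse-∷-< r i c r<n rewrite unfold-reverse i c =
  entryAt-∷ʳ-< r (reverse c) i (subst (r <_) (sym (length-reverse c)) r<n)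

entryAt-reverse-∷-length : ∀ i c → entryAt (length c) (reverse (i ∷ c)) ≡ i
entryAt-reverse-∷-length i c rewrite unfold-reverse i c | sym (length-reverse c) =
  entryAt-∷ʳ-length (reverse c) i

entryAt-reverse-≥length : ∀ r c → length c ≤ r → entryAt r (reverse c) ≡ 0
entryAt-reverse-≥length r c n≤r = entryAt-≥length r (reverse c) (subst (_≤ r) (sym (length-reverse c)) n≤r)

emptyColumns : List (List ℕ) → ℕ
emptyColumns [] = 0
emptyColumns ([] ∷ cs) = suc (emptyColumns cs)
emptyColumns ((_ ∷ _) ∷ cs) = emptyColumns cs

rowSum : ℕ → List (List ℕ) → ℕ
rowSum r cs = sum (rowOf r (map reverse cs))

emptyColumns-placeTop : ∀ i cs → 0 < emptyColumns cs → suc (emptyColumns (placeTop i cs)) ≡ emptyColumns cs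
emptyColumns-placeTop i ([] ∷ cs) _ = refl
emptyColumns-placeTop i ((x ∷ c) ∷ cs) pos = emptyColumns-placeTop i cs pos

rowSum₀-placeTop : ∀ i cs → 0 < emptyColumns cs → rowSum 0 (placeTop i cs) ≡ rowSum 0 cs + i
rowSum₀-placeTop i ([] ∷ cs) _ = +-comm i (rowSum 0 cs)
rowSum₀-placeTop i ((x ∷ c) ∷ cs) pos =
  trans (cong (entryAt 0 (reverse (x ∷ c)) +_) (rowSum₀-placeTop i cs pos)) (sym (+-assoc _ (rowSum 0 cs) i))

rowSum-suc-placeTop : ∀ r i cs → rowSum (suc r) (placeTop i cs) ≡ rowSum (suc r) cs
rowSum-suc-placeTop r i [] = refl
rowSum-suc-placeTop r i ([] ∷ cs) = refl
rowSum-suc-placeTop r i ((x ∷ c) ∷ cs) = cong (entryAt (suc r) (reverse (x ∷ c)) +_) (rowSum-suc-placeTop r i cs)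

module _ (k v i : ℕ) where

  emptyColumns-insertBelow : ∀ cs → emptyColumns (insertBelow k v i cs) ≡ emptyColumns cs
  emptyColumns-insertBelow [] = refl
  emptyColumns-insertBelow ([] ∷ cs) = cong suc (emptyColumns-insertBelow cs)
  emptyColumns-insertBelow ((x ∷ c) ∷ cs) with isActive k (x ∷ c) ∧ ⌊ x ≟ v ⌋
  ... | true = refl
  ... | false = emptyColumns-insertBelow cs

  rowSum₀-insertBelow : ∀ cs → rowSum 0 (insertBelow k v i cs) ≡ rowSum 0 cs
  rowSum₀-insertBelow [] = refl
  rowSum₀-insertBelow ([] ∷ cs) = rowSum₀-insertBelow cs
  rowSum₀-insertBelow ((x ∷ c) ∷ cs) with isActive k (x ∷ c) ∧ ⌊ x ≟ v ⌋
  ... | true = cong (_+ rowSum 0 cs) (entryAt-reverse-∷-< 0 i (x ∷ c) (s≤s z≤n))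
  ... | false = cong (entryAt 0 (reverse (x ∷ c)) +_) (rowSum₀-insertBelow cs)

module _ (k i : ℕ) where

  emptyColumns-fillStep-east : ∀ cs → emptyColumns (fillStep k i cs east) ≡ emptyColumns cs
  emptyColumns-fillStep-east cs with minimumMaybe (activeEntries k cs)
  ... | nothing = refl
  ... | just v = emptyColumns-insertBelow k v i cs

  rowSum₀-fillStep-east : ∀ cs → rowSum 0 (fillStep k i cs east) ≡ rowSum 0 cs
  rowSum₀-fillStep-east cs with minimumMaybe (activeEntries k cs)
  ... | nothing = refl
  ... | just v = rowSum₀-insertBelow k v i cs

∸≡suc∸suc : ∀ {a b} → a < b → b ∸ a ≡ suc (b ∸ suc a)
∸≡suc∸suc a<b = +-∸-assoc 1 a<b

<ᵇ≡true⇒< : ∀ {a b} → (a <ᵇ b) ≡ true → a < b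
<ᵇ≡true⇒< {a} {b} eq = <ᵇ⇒< a b (subst T (sym eq) _)

<ᵇ≡false⇒≥ : ∀ {a b} → (a <ᵇ b) ≡ false → b ≤ a
<ᵇ≡false⇒≥ eq = ≮⇒≥ (λ lt → subst T eq (<⇒<ᵇ lt))

minimumMaybe-nothing : ∀ xs → minimumMaybe xs ≡ nothing → xs ≡ []
minimumMaybe-nothing [] _ = refl
minimumMaybe-nothing (x ∷ xs) eq with minimumMaybe xs
minimumMaybe-nothing (x ∷ xs) () | nothing
minimumMaybe-nothing (x ∷ xs) () | just _

minimumMaybe-just : ∀ xs {v} → minimumMaybe xs ≡ just v → v ∈ xs × All (v ≤_) xs
minimumMaybe-just (x ∷ xs) eq with minimumMaybe xs in eq′
minimumMaybe-just (x ∷ xs) refl | nothing rewrite minimumMaybe-nothing xs eq′ = here refl , ≤-refl ∷ []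
minimumMaybe-just (x ∷ xs) eq | just y with minimumMaybe-just xs eq′ | x <ᵇ y in x<y
minimumMaybe-just (x ∷ xs) refl | just y | _ , y≤xs | true =
  here refl , ≤-refl ∷ All.map (≤-trans (<⇒≤ (<ᵇ≡true⇒< x<y))) y≤xs
minimumMaybe-just (x ∷ xs) refl | just y | y∈xs , y≤xs | false = there y∈xs , <ᵇ≡false⇒≥ x<y ∷ y≤xs

columnSlots : ℕ → List ℕ → List Slot
columnSlots k [] = []
columnSlots k (x ∷ c) = if isActive k (x ∷ c) then [ (x , k ∸ length c) ] else []

queue : ℕ → List (List ℕ) → List Slot
queue k = concatMap (columnSlots k)

module _ (k : ℕ) where

  map-entry-queue : ∀ cs → map entry (queue k cs) ≡ activeEntries k cs
  map-entry-queue [] = refl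
  map-entry-queue ([] ∷ cs) = map-entry-queue cs
  map-entry-queue ((x ∷ c) ∷ cs) with isActive k (x ∷ c)
  ... | true = cong (x ∷_) (map-entry-queue cs)
  ... | false = map-entry-queue cs

  queue-bounded : ∀ cs → All (λ s → 1 ≤ deficit s × deficit s ≤ k) (queue k cs)
  queue-bounded [] = []
  queue-bounded ([] ∷ cs) = queue-bounded cs
  queue-bounded ((x ∷ c) ∷ cs) with isActive k (x ∷ c) in active
  ... | true = (m<n⇒0<n∸m (<ᵇ≡true⇒< {length c} {k} active) , m∸n≤m k (length c)) ∷ queue-bounded cs
  ... | false = queue-bounded cs

  data Served (v i : ℕ) (cs cs′ : List (List ℕ)) : Set where
    completed : ∀ {X} → queue k cs ↭ (v , 1) ∷ X → queue k cs′ ↭ X →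
                rowSum k cs′ ≡ rowSum k cs + i → Served v i cs cs′
    requeued : ∀ {d X} → queue k cs ↭ (v , suc (suc d)) ∷ X → queue k cs′ ↭ (i , suc d) ∷ X →
               rowSum k cs′ ≡ rowSum k cs → Served v i cs cs′

  Served-∷ : ∀ {v i cs cs′} c → Served v i cs cs′ → Served v i (c ∷ cs) (c ∷ cs′)
  Served-∷ {v} {i} {cs} c (completed {X} before after bottom) =
    completed (↭-trans (++⁺ˡ S before) (shift (v , 1) S X)) (++⁺ˡ S after)
              (trans (cong (entryAt k (reverse c) +_) bottom) (sym (+-assoc (entryAt k (reverse c)) (rowSum k cs) i)))
    where S = columnSlots k c
  Served-∷ {v} {i} c (requeued {d} {X} before after bottom) =
    requeued (↭-trans (++⁺ˡ S before) (shift (v , suc (suc d)) S X))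
             (↭-trans (++⁺ˡ S after) (shift (i , suc d) S X))
             (cong (entryAt k (reverse c) +_) bottom)
    where S = columnSlots k c

  queue-active : ∀ x c cs → isActive k (x ∷ c) ≡ true → queue k ((x ∷ c) ∷ cs) ≡ (x , k ∸ length c) ∷ queue k cs
  queue-active x c cs active rewrite active = refl

  queue-inactive : ∀ x c cs → isActive k (x ∷ c) ≡ false → queue k ((x ∷ c) ∷ cs) ≡ queue k cs
  queue-inactive x c cs inactive rewrite inactive = refl

  serve-column : ∀ i x c cs → isActive k (x ∷ c) ≡ true → Served x i ((x ∷ c) ∷ cs) ((i ∷ x ∷ c) ∷ cs)
  serve-column i x c cs active with isActive k (i ∷ x ∷ c) in active′
  ... | true = requeued (↭-reflexive before) (↭-reflexive after) bottom
    where
    c<k = <ᵇ≡true⇒< {length c} {k} active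
    sc<k = <ᵇ≡true⇒< {suc (length c)} {k} active′
    before : queue k ((x ∷ c) ∷ cs) ≡ (x , suc (suc (k ∸ suc (suc (length c))))) ∷ queue k cs
    before = trans (queue-active x c cs active)
                   (cong (λ d → (x , d) ∷ queue k cs) (trans (∸≡suc∸suc c<k) (cong suc (∸≡suc∸suc sc<k))))
    after : queue k ((i ∷ x ∷ c) ∷ cs) ≡ (i , suc (k ∸ suc (suc (length c)))) ∷ queue k cs
    after = trans (queue-active i (x ∷ c) cs active′) (cong (λ d → (i , d) ∷ queue k cs) (∸≡suc∸suc sc<k))
    bottom : entryAt k (reverse (i ∷ x ∷ c)) + rowSum k cs ≡ entryAt k (reverse (x ∷ c)) + rowSum k cs
    bottom = cong (_+ rowSum k cs) (trans (entryAt-reverse-≥length k (i ∷ x ∷ c) sc<k)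
                                          (sym (entryAt-reverse-≥length k (x ∷ c) (<⇒≤ sc<k))))
  ... | false = completed (↭-reflexive before) (↭-reflexive (queue-inactive i (x ∷ c) cs active′)) bottom
    where
    open ≡-Reasoning
    k≡sc : k ≡ suc (length c)
    k≡sc = ≤-antisym (<ᵇ≡false⇒≥ {suc (length c)} {k} active′) (<ᵇ≡true⇒< {length c} {k} active)
    before : queue k ((x ∷ c) ∷ cs) ≡ (x , 1) ∷ queue k cs
    before = trans (queue-active x c cs active)
                   (cong (λ d → (x , d) ∷ queue k cs) (trans (cong (_∸ length c) k≡sc) (m+n∸n≡m 1 (length c))))
    bottom : entryAt k (reverse (i ∷ x ∷ c)) + rowSum k cs ≡ entryAt k (reverse (x ∷ c)) + rowSum k cs + i
    bottom = begin
        entryAt k (reverse (i ∷ x ∷ c)) + rowSum k cs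
      ≡⟨ cong (λ r → entryAt r (reverse (i ∷ x ∷ c)) + rowSum k cs) k≡sc ⟩
        entryAt (length (x ∷ c)) (reverse (i ∷ x ∷ c)) + rowSum k cs
      ≡⟨ cong (_+ rowSum k cs) (entryAt-reverse-∷-length i (x ∷ c)) ⟩
        i + rowSum k cs
      ≡⟨ +-comm i (rowSum k cs) ⟩
        rowSum k cs + i
      ≡⟨ cong (λ z → z + rowSum k cs + i) (entryAt-reverse-≥length k (x ∷ c) (≤-reflexive (sym k≡sc))) ⟨
        entryAt k (reverse (x ∷ c)) + rowSum k cs + i
      ∎

  insertBelow-served : ∀ {v} i cs → Any (λ s → v ≡ entry s) (queue k cs) → Served v i cs (insertBelow k v i cs)
  insertBelow-served i ([] ∷ cs) v∈ = Served-∷ [] (insertBelow-served i cs v∈)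
  insertBelow-served {v} i ((x ∷ c) ∷ cs) v∈ with isActive k (x ∷ c) in active
  ... | false = Served-∷ (x ∷ c) (insertBelow-served i cs v∈)
  ... | true with x ≟ v | v∈
  ...   | yes refl | _ = serve-column i x c cs active
  ...   | no x≢v | here v≡x = ⊥-elim (x≢v (sym v≡x))
  ...   | no x≢v | there v∈′ = Served-∷ (x ∷ c) (insertBelow-served i cs v∈′)

  fillStep-east-served : ∀ i cs → 0 < deficitSum (queue k cs) →
    ∃ λ v → All (λ s → v ≤ entry s) (queue k cs) × Served v i cs (fillStep k i cs east)
  fillStep-east-served i cs pos with minimumMaybe (activeEntries k cs) in min
  ... | nothing = ⊥-elim (empty (queue k cs) (trans (map-entry-queue cs) (minimumMaybe-nothing _ min)) pos)
    where
    empty : ∀ q → map entry q ≡ [] → 0 < deficitSum q → ⊥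
    empty [] _ ()
  ... | just v with minimumMaybe-just _ min
  ...   | v∈ , v≤ =
    v , All.map⁻ (subst (All (v ≤_)) (sym (map-entry-queue cs)) v≤) ,
    insertBelow-served i cs (Any.map⁻ (subst (v ∈_) (sym (map-entry-queue cs)) v∈))

queue-placeTop : ∀ k′ i cs → 0 < emptyColumns cs → queue (suc k′) (placeTop i cs) ↭ (i , suc k′) ∷ queue (suc k′) cs
queue-placeTop k′ i ([] ∷ cs) _ = ↭-refl
queue-placeTop k′ i ((x ∷ c) ∷ cs) pos =
  ↭-trans (++⁺ˡ S (queue-placeTop k′ i cs pos)) (shift (i , suc k′) S (queue (suc k′) cs))
  where S = columnSlots (suc k′) (x ∷ c)

emptyColumns-replicate : ∀ e → emptyColumns (replicate e []) ≡ e
emptyColumns-replicate zero = refl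
emptyColumns-replicate (suc e) = cong suc (emptyColumns-replicate e)

queue-replicate : ∀ k e → queue k (replicate e []) ≡ []
queue-replicate k zero = refl
queue-replicate k (suc e) = queue-replicate k e

rowSum-replicate : ∀ r e → rowSum r (replicate e []) ≡ 0
rowSum-replicate r zero = refl
rowSum-replicate (suc r) (suc e) = rowSum-replicate (suc r) e
rowSum-replicate zero (suc e) = rowSum-replicate zero e

deficitSum≡0⇒[] : ∀ {A} → All (λ s → 1 ≤ deficit s) A → deficitSum A ≡ 0 → A ≡ []
deficitSum≡0⇒[] [] _ = refl
deficitSum≡0⇒[] (s≤s _ ∷ _) ()

-- Lattice paths

module Count {P : ℕ → Set} (P? : U.Decidable P) {a b : ℕ}
  (sound : ∀ {z} → P z → a ≤ z × z < b) (complete : ∀ {z} → a ≤ z → z < b → P z) where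

  filter-reject-+ : ∀ {N} c → ¬ P N → c + length (filter P? [ N ]) ≡ c
  filter-reject-+ c ¬PN = trans (cong (λ l → c + length l) (filter-reject P? ¬PN)) (+-identityʳ c)

  count-step : ∀ N → b ⊓ N ∸ a + length (filter P? [ N ]) ≡ b ⊓ suc N ∸ a
  count-step N with N <? b | a ≤? N
  ... | yes N<b | yes a≤N = begin
      b ⊓ N ∸ a + length (filter P? [ N ])
    ≡⟨ cong₂ (λ m l → m ∸ a + length l) (m≥n⇒m⊓n≡n (<⇒≤ N<b)) (filter-accept P? (complete a≤N N<b)) ⟩
      N ∸ a + 1
    ≡⟨ +-∸-comm 1 a≤N ⟨
      N + 1 ∸ a
    ≡⟨ cong (_∸ a) (trans (+-comm N 1) (sym (m≥n⇒m⊓n≡n N<b))) ⟩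
      b ⊓ suc N ∸ a
    ∎
    where open ≡-Reasoning
  ... | yes N<b | no a≰N = begin
      b ⊓ N ∸ a + length (filter P? [ N ])
    ≡⟨ filter-reject-+ (b ⊓ N ∸ a) (a≰N ∘ proj₁ ∘ sound) ⟩
      b ⊓ N ∸ a
    ≡⟨ m≤n⇒m∸n≡0 (≤-trans (m⊓n≤n b N) (<⇒≤ (≰⇒> a≰N))) ⟩
      0
    ≡⟨ m≤n⇒m∸n≡0 (≤-trans (m⊓n≤n b (suc N)) (≰⇒> a≰N)) ⟨
      b ⊓ suc N ∸ a
    ∎
    where open ≡-Reasoning
  ... | no N≮b | _ = let b≤N = ≮⇒≥ N≮b in begin
      b ⊓ N ∸ a + length (filter P? [ N ])
    ≡⟨ filter-reject-+ (b ⊓ N ∸ a) (N≮b ∘ proj₂ ∘ sound) ⟩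
      b ⊓ N ∸ a
    ≡⟨ cong (_∸ a) (trans (m≤n⇒m⊓n≡m b≤N) (sym (m≤n⇒m⊓n≡m (≤-trans b≤N (n≤1+n N))))) ⟩
      b ⊓ suc N ∸ a
    ∎
    where open ≡-Reasoning

  length-filter-upTo : ∀ N → length (filter P? (upTo N)) ≡ b ⊓ N ∸ a
  length-filter-upTo zero = sym (trans (cong (_∸ a) (⊓-zeroʳ b)) (0∸n≡0 a))
  length-filter-upTo (suc N) = begin
      length (filter P? (upTo (suc N)))
    ≡⟨ cong (length ∘ filter P?) (upTo-∷ʳ N) ⟨
      length (filter P? (upTo N ++ [ N ]))
    ≡⟨ cong length (filter-++ P? (upTo N) [ N ]) ⟩
      length (filter P? (upTo N) ++ filter P? [ N ])
    ≡⟨ length-++ (filter P? (upTo N)) ⟩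
      length (filter P? (upTo N)) + length (filter P? [ N ])
    ≡⟨ cong (_+ length (filter P? [ N ])) (length-filter-upTo N) ⟩
      b ⊓ N ∸ a + length (filter P? [ N ])
    ≡⟨ count-step N ⟩
      b ⊓ suc N ∸ a
    ∎
    where open ≡-Reasoning

-- A path from (x , y) to (x′ , y′) whose north steps start below row n and weakly left of the line
-- x = k y, and whose east steps start strictly left of it: the letters of a Dyck path in 𝒟_{kn+1,n}
-- that the filling algorithm reads.
data Feasible (k n : ℕ) : ℕ → ℕ → List Step → ℕ → ℕ → Set where
  done : ∀ {x y} → Feasible k n x y [] x y
  up : ∀ {x y w x′ y′} → y < n → x ≤ k * y →
       Feasible k n x (suc y) w x′ y′ → Feasible k n x y (north ∷ w) x′ y′
  right : ∀ {x y w x′ y′} → x < k * y → Feasible k n (suc x) y w x′ y′ → Feasible k n x y (east ∷ w) x′ y′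

northSum : (ℕ → ℕ → ℕ) → ℕ → ℕ → List Step → ℕ
northSum f x y [] = 0
northSum f x y (north ∷ w) = f x y + northSum f x (suc y) w
northSum f x y (east ∷ w) = northSum f (suc x) y w

areaFrom≡northSum : ∀ m n x y w → areaFrom m n x y w ≡ northSum (cellsInRow m n) x y w
areaFrom≡northSum m n x y [] = refl
areaFrom≡northSum m n x y (north ∷ w) = cong (cellsInRow m n x y +_) (areaFrom≡northSum m n x (suc y) w)
areaFrom≡northSum m n x y (east ∷ w) = areaFrom≡northSum m n (suc x) y w

northSum-combine : ∀ {k n x y w x′ y′} {f g h : ℕ → ℕ → ℕ} → Feasible k n x y w x′ y′ →
  (∀ {x y} → y < n → x ≤ k * y → f x y + g x y ≡ h x y) →
  northSum f x y w + northSum g x y w ≡ northSum h x y w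
northSum-combine done fgh = refl
northSum-combine {x = x} {y} {north ∷ w} {f = f} {g} (up y<n x≤ky path) fgh =
  trans (interchange (f x y) (northSum f x (suc y) w) (g x y) (northSum g x (suc y) w))
        (cong₂ _+_ (fgh y<n x≤ky) (northSum-combine path fgh))
northSum-combine (right _ path) fgh = northSum-combine path fgh

Feasible-length : ∀ {k n x y w x′ y′} → Feasible k n x y w x′ y′ → x + y + length w ≡ x′ + y′
Feasible-length done = +-identityʳ _
Feasible-length {x = x} {y} {north ∷ w} (up _ _ path) =
  trans (trans (+-suc (x + y) (length w)) (cong (_+ length w) (sym (+-suc x y)))) (Feasible-length path)
Feasible-length {w = east ∷ w} (right _ path) = trans (+-suc _ (length w)) (Feasible-length path)

Feasible-monotone : ∀ {k n x y w x′ y′} → Feasible k n x y w x′ y′ → x ≤ x′ × y ≤ y′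
Feasible-monotone done = ≤-refl , ≤-refl
Feasible-monotone (up _ _ path) with Feasible-monotone path
... | x≤ , y≤ = x≤ , <⇒≤ y≤
Feasible-monotone (right _ path) with Feasible-monotone path
... | x≤ , y≤ = <⇒≤ x≤ , y≤

northSum-∷ʳ-east : ∀ f x y w → northSum f x y (w ++ [ east ]) ≡ northSum f x y w
northSum-∷ʳ-east f x y [] = refl
northSum-∷ʳ-east f x y (north ∷ w) = cong (f x y +_) (northSum-∷ʳ-east f x (suc y) w)
northSum-∷ʳ-east f x y (east ∷ w) = northSum-∷ʳ-east f (suc x) y w

suc-C2 : ∀ z → suc z C 2 ≡ z + z C 2
suc-C2 z = trans (sym (nCk+nC[k+1]≡[n+1]C[k+1] z 1)) (cong (_+ z C 2) (nC1≡n z))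

northSum-affine : ∀ {k n x y w x′ y′} a b → Feasible k n x y w x′ y′ →
  northSum (λ _ y → a + b * y) x y w + (y * a + b * (y C 2)) ≡ y′ * a + b * (y′ C 2)
northSum-affine a b done = refl
northSum-affine {x = x} {y} {north ∷ w} a b (up _ _ path) = trans step (northSum-affine a b path)
  where
  N = northSum (λ _ y → a + b * y) x (suc y) w
  rearrange : ∀ a b y N c → a + b * y + N + (y * a + b * c) ≡ N + (suc y * a + b * (y + c))
  rearrange = solve-∀
  step : a + b * y + N + (y * a + b * (y C 2)) ≡ N + (suc y * a + b * (suc y C 2))
  step = trans (rearrange a b y N (y C 2)) (cong (λ c → N + (suc y * a + b * c)) (sym (suc-C2 y)))
northSum-affine a b (right _ path) = northSum-affine a b path

eastCount northCount : List Step → ℕ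
eastCount [] = 0
eastCount (north ∷ w) = eastCount w
eastCount (east ∷ w) = suc (eastCount w)
northCount [] = 0
northCount (north ∷ w) = suc (northCount w)
northCount (east ∷ w) = northCount w

endpoint≡counts : ∀ w → endpoint w ≡ (eastCount w , northCount w)
endpoint≡counts [] = refl
endpoint≡counts (north ∷ w) rewrite endpoint≡counts w = refl
endpoint≡counts (east ∷ w) rewrite endpoint≡counts w = refl

AboveFrom-here : ∀ {m n x y} w → AboveFrom m n x y w → n * x ≤ m * y
AboveFrom-here [] above = above
AboveFrom-here (north ∷ w) (nx≤my , _) = nx≤my
AboveFrom-here (east ∷ w) (nx≤my , _) = nx≤my

module _ (k n : ℕ) where

  [k*n+1]*y≡n*[k*y]+y : ∀ y → (k * n + 1) * y ≡ n * (k * y) + y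
  [k*n+1]*y≡n*[k*y]+y y = expand k n y
    where
    expand : ∀ k n y → (k * n + 1) * y ≡ n * (k * y) + y
    expand = solve-∀

  above⇒≤k*y : ∀ {a y} → y < n → n * a ≤ (k * n + 1) * y → a ≤ k * y
  above⇒≤k*y {a} {y} y<n le = ≮⇒≥ λ ky<a → <⇒≱ y<n (+-cancelˡ-≤ (n * (k * y)) n y (begin
      n * (k * y) + n   ≡⟨ +-comm (n * (k * y)) n ⟩
      n + n * (k * y)   ≡⟨ *-suc n (k * y) ⟨
      n * suc (k * y)   ≤⟨ *-monoʳ-≤ n ky<a ⟩
      n * a             ≤⟨ le ⟩
      (k * n + 1) * y   ≡⟨ [k*n+1]*y≡n*[k*y]+y y ⟩
      n * (k * y) + y   ∎))
    where open ≤-Reasoning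

  ≤k*y⇒above : ∀ {a y} → a ≤ k * y → n * a ≤ (k * n + 1) * y
  ≤k*y⇒above {a} {y} a≤ky = begin
    n * a             ≤⟨ *-monoʳ-≤ n a≤ky ⟩
    n * (k * y)       ≤⟨ m≤m+n (n * (k * y)) y ⟩
    n * (k * y) + y   ≡⟨ [k*n+1]*y≡n*[k*y]+y y ⟨
    (k * n + 1) * y   ∎
    where open ≤-Reasoning

  cellsInRow≡k*y∸x : ∀ x y → y < n → cellsInRow (k * n + 1) n x y ≡ k * y ∸ x
  cellsInRow≡k*y∸x x y y<n =
    trans (Count.length-filter-upTo _ sound complete (k * n + 1)) (cong (_∸ x) (m≤n⇒m⊓n≡m ky≤m))
    where
    sound : ∀ {z} → x ≤ z × n * suc z ≤ (k * n + 1) * y → x ≤ z × z < k * y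
    sound (x≤z , le) = x≤z , above⇒≤k*y y<n le
    complete : ∀ {z} → x ≤ z → z < k * y → x ≤ z × n * suc z ≤ (k * n + 1) * y
    complete x≤z z<ky = x≤z , ≤k*y⇒above z<ky
    ky≤m : k * y ≤ k * n + 1
    ky≤m = ≤-trans (*-monoʳ-≤ k (<⇒≤ y<n)) (m≤m+n (k * n) 1)

  prefix-feasible : ∀ ys z {x y} → AboveFrom (k * n + 1) n x y (ys ++ [ z ]) →
    x + eastCount (ys ++ [ z ]) ≡ k * n + 1 → y + northCount (ys ++ [ z ]) ≡ n →
    z ≡ east × Feasible k n x y ys (k * n) n
  prefix-feasible [] north {x} {y} (nx≤my , _) ex ey = ⊥-elim (1+n≰n (begin
      suc (k * n)   ≡⟨ +-comm 1 (k * n) ⟩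
      k * n + 1     ≡⟨ trans (sym ex) (+-identityʳ x) ⟩
      x             ≤⟨ above⇒≤k*y y<n nx≤my ⟩
      k * y         ≤⟨ *-monoʳ-≤ k (<⇒≤ y<n) ⟩
      k * n         ∎))
    where
    open ≤-Reasoning
    y<n : y < n
    y<n = subst (y <_) ey (m<m+n y (s≤s z≤n))
  prefix-feasible [] east {x} {y} _ x+1≡m y≡n =
    refl , subst₂ (Feasible k n x y []) (+-cancelʳ-≡ 1 x (k * n) x+1≡m) (trans (sym (+-identityʳ y)) y≡n) done
  prefix-feasible (north ∷ ys) z {x} {y} (nx≤my , above) ex ey with prefix-feasible ys z above ex (trans (sym (+-suc y _)) ey)
  ... | z≡east , path = z≡east , up y<n (above⇒≤k*y y<n nx≤my) path
    where
    y<n : y < n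
    y<n = ≤-trans (s≤s (m≤m+n y _)) (≤-reflexive (trans (sym (+-suc y _)) ey))
  prefix-feasible (east ∷ ys) z {x} {y} (_ , above) ex ey with prefix-feasible ys z above (trans (sym (+-suc x _)) ex) ey
  ... | z≡east , path = z≡east , right x<ky path
    where
    x<ky : x < k * y
    x<ky with y <? n
    ... | yes y<n = above⇒≤k*y y<n (AboveFrom-here (ys ++ [ z ]) above)
    ... | no y≮n with Feasible-monotone path
    ...   | x<kn , y≤n = subst (λ y → x < k * y) (≤-antisym (≮⇒≥ y≮n) y≤n) x<kn

  dyck-shape : ∀ {D} → 1 ≤ n → IsDyck (k * n + 1) n D →
    ∃ λ ys → D ≡ north ∷ ys ++ [ east ] × Feasible k n 0 1 ys (k * n) n
  dyck-shape {[]} 1≤n (ends , _) = ⊥-elim (<-irrefl (cong proj₂ ends) 1≤n)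
  dyck-shape {east ∷ w} 1≤n (_ , _ , above) = ⊥-elim (1+n≰n (begin
      1               ≤⟨ 1≤n ⟩
      n               ≡⟨ *-identityʳ n ⟨
      n * 1           ≤⟨ AboveFrom-here w above ⟩
      (k * n + 1) * 0 ≡⟨ *-zeroʳ (k * n + 1) ⟩
      0               ∎))
    where open ≤-Reasoning
  dyck-shape {north ∷ w} 1≤n (ends , _ , above) with initLast w
  ... | [] = ⊥-elim (0≢1+n (trans (cong proj₁ ends) (+-comm (k * n) 1)))
  ... | ys ∷ʳ′ z with prefix-feasible ys z above (cong proj₁ ends′) (cong proj₂ ends′)
    where
    ends′ = trans (sym (endpoint≡counts (north ∷ ys ++ [ z ]))) ends
  ...   | refl , path = ys , refl , path

-- Invariants of the filling algorithm

m+n≡o⇒n<o⇒0<m : ∀ {m n o} → m + n ≡ o → n < o → 0 < m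
m+n≡o⇒n<o⇒0<m {zero} refl n<n = ⊥-elim (<-irrefl refl n<n)
m+n≡o⇒n<o⇒0<m {suc m} _ _ = s≤s z≤n

rowSum₀-fillRun : ∀ {k n x y w x′ y′} t cs → Feasible k n x y w x′ y′ →
  t ≡ suc (x + y) → emptyColumns cs + y ≡ n →
  rowSum 0 (fillRun k t cs w) ≡ rowSum 0 cs + northSum (λ x y → suc (x + y)) x y w
rowSum₀-fillRun t cs done _ _ = sym (+-identityʳ _)
rowSum₀-fillRun {k} {x = x} {y} {north ∷ w} t cs (up y<n _ path) refl empties = begin
    rowSum 0 (fillRun k (suc t) (placeTop t cs) w)
  ≡⟨ rowSum₀-fillRun (suc t) (placeTop t cs) path (cong suc (sym (+-suc x y))) empties′ ⟩
    rowSum 0 (placeTop t cs) + northSum _ x (suc y) w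
  ≡⟨ cong (_+ northSum _ x (suc y) w) (rowSum₀-placeTop t cs pos) ⟩
    rowSum 0 cs + t + northSum _ x (suc y) w
  ≡⟨ +-assoc (rowSum 0 cs) t _ ⟩
    rowSum 0 cs + (t + northSum _ x (suc y) w)
  ∎
  where
  open ≡-Reasoning
  pos = m+n≡o⇒n<o⇒0<m empties y<n
  empties′ = trans (+-suc _ y) (trans (cong (_+ y) (emptyColumns-placeTop t cs pos)) empties)
rowSum₀-fillRun {k} t cs (right _ path) refl empties =
  trans (rowSum₀-fillRun (suc t) (fillStep k t cs east) path refl (trans (cong (_+ _) (emptyColumns-fillStep-east k t cs)) empties))
        (cong (_+ _) (rowSum₀-fillStep-east k t cs))

-- The state before the letter with index t, which starts at (x , y).  The total deficit of the active
-- columns equals the number k y − x of cells of row y to the right of the path.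
record Invariant (k n t x y : ℕ) (cs : List (List ℕ)) : Set where
  field
    index : t ≡ suc (x + y)
    empties : emptyColumns cs + y ≡ n
    deficits : deficitSum (queue k cs) + x ≡ k * y
    earlier : All (λ s → entry s < t) (queue k cs)
    distinct : Distinct (queue k cs)

module _ {k n t x y : ℕ} {cs : List (List ℕ)} (inv : Invariant k n t x y cs) where
  open Invariant inv

  record QueueTail (v d : ℕ) (X : List Slot) : Set where
    field
      later : All (λ s → v < entry s) X
      earlierX : All (λ s → entry s < t) X
      distinctX : Distinct X
      positiveX : All (λ s → 1 ≤ deficit s) X
      deficitsX : d + deficitSum X + x ≡ k * y

  queue-tail : ∀ {v d X} → All (λ s → v ≤ entry s) (queue k cs) → queue k cs ↭ (v , d) ∷ X → QueueTail v d X
  queue-tail minimal perm with Distinct-resp-↭ perm distinct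
  ... | v≢X ∷ distinctX = record
    { later = All.zipWith (λ (v≤ , v≢) → ≤∧≢⇒< v≤ v≢) (All.tail (All-resp-↭ perm minimal) , v≢X)
    ; earlierX = All.tail (All-resp-↭ perm earlier)
    ; distinctX = distinctX
    ; positiveX = All.map proj₁ (All.tail (All-resp-↭ perm (queue-bounded k cs)))
    ; deficitsX = trans (cong (_+ x) (sym (sum-map-↭ deficit perm))) deficits
    }

  east-invariant : let cs′ = fillStep k t cs east in ∀ {Y} → queue k cs′ ↭ Y →
    deficitSum Y + suc x ≡ k * y → All (λ s → entry s < suc t) Y → Distinct Y → Invariant k n (suc t) (suc x) y cs′
  east-invariant perm deficits′ earlier′ distinct′ = record
    { index = cong suc index
    ; empties = trans (cong (_+ y) (emptyColumns-fillStep-east k t cs)) empties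
    ; deficits = trans (cong (_+ suc x) (sum-map-↭ deficit perm)) deficits′
    ; earlier = All-resp-↭ (↭-sym perm) earlier′
    ; distinct = Distinct-resp-↭ (↭-sym perm) distinct′
    }

  east-step : x < k * y → let cs′ = fillStep k t cs east in
    Invariant k n (suc t) (suc x) y cs′ × rowSum k cs′ + Φ (suc t) (queue k cs′) ≡ rowSum k cs + Φ t (queue k cs)
  east-step x<ky with fillStep-east-served k t cs (m+n≡o⇒n<o⇒0<m deficits x<ky)
  ... | v , minimal , completed {X} before after bottom =
    east-invariant after (trans (+-suc _ x) deficitsX) (All.map m<n⇒m<1+n earlierX) distinctX ,
    (begin
      rowSum k cs′ + Φ (suc t) (queue k cs′)
    ≡⟨ cong₂ _+_ bottom (Φ-↭ (suc t) after) ⟩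
      rowSum k cs + t + Φ (suc t) X
    ≡⟨ trans (+-assoc (rowSum k cs) t _) (cong (rowSum k cs +_) (+-comm t _)) ⟩
      rowSum k cs + (Φ (suc t) X + t)
    ≡⟨ cong (rowSum k cs +_) (trans (sym (Φ-retire t v X later positiveX)) (sym (Φ-↭ t before))) ⟩
      rowSum k cs + Φ t (queue k cs)
    ∎)
    where
    open ≡-Reasoning
    open QueueTail (queue-tail minimal before)
    cs′ = fillStep k t cs east
  ... | v , minimal , requeued {d} {X} before after bottom =
    east-invariant after (trans (+-suc _ x) deficitsX)
      (n<1+n t ∷ All.map m<n⇒m<1+n earlierX) (All.map >⇒≢ earlierX ∷ distinctX) ,
    (begin
      rowSum k cs′ + Φ (suc t) (queue k cs′)
    ≡⟨ cong₂ _+_ bottom (Φ-↭ (suc t) after) ⟩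
      rowSum k cs + Φ (suc t) ((t , suc d) ∷ X)
    ≡⟨ cong (rowSum k cs +_) (trans (sym (Φ-requeue t v d X (All.zip (later , earlierX)) positiveX)) (sym (Φ-↭ t before))) ⟩
      rowSum k cs + Φ t (queue k cs)
    ∎)
    where
    open ≡-Reasoning
    open QueueTail (queue-tail minimal before)
    cs′ = fillStep k t cs east

enqueue-growth : ∀ k {t x y D} → t ≡ suc (x + y) → D + x ≡ k * y →
  2 * D + t + k ≡ k * y ∸ x + (suc k + suc k * y)
enqueue-growth k {t} {x} {y} {D} refl D+x≡ky = begin
    2 * D + suc (x + y) + k
  ≡⟨ rearrange D x y k ⟩
    D + (suc k + (y + (D + x)))
  ≡⟨ cong₂ (λ a b → a + (suc k + (y + b))) D≡ky∸x D+x≡ky ⟩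
    k * y ∸ x + (suc k + suc k * y)
  ∎
  where
  open ≡-Reasoning
  D≡ky∸x : D ≡ k * y ∸ x
  D≡ky∸x = trans (sym (m+n∸n≡m D x)) (cong (_∸ x) D+x≡ky)
  rearrange : ∀ D x y k → 2 * D + suc (x + y) + k ≡ D + (suc k + (y + (D + x)))
  rearrange = solve-∀

north-step : ∀ {k′ n t x y cs} → Invariant (suc k′) n t x y cs → y < n → let k = suc k′ ; cs′ = placeTop t cs in
  Invariant k n (suc t) x (suc y) cs′ ×
  rowSum k cs′ + Φ (suc t) (queue k cs′) ≡ rowSum k cs + Φ t (queue k cs) + (k * y ∸ x + (suc k + suc k * y))
north-step {k′} {n} {t} {x} {y} {cs} inv y<n = invariant′ , (begin
    rowSum k cs′ + Φ (suc t) (queue k cs′)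
  ≡⟨ cong₂ _+_ (rowSum-suc-placeTop k′ t cs) (Φ-↭ (suc t) perm) ⟩
    rowSum k cs + Φ (suc t) ((t , k) ∷ Q)
  ≡⟨ cong (rowSum k cs +_) (Φ-enqueue k′ t Q earlier (queue-bounded k cs)) ⟩
    rowSum k cs + (Φ t Q + (2 * D + t + k))
  ≡⟨ sym (+-assoc (rowSum k cs) (Φ t Q) _) ⟩
    rowSum k cs + Φ t Q + (2 * D + t + k)
  ≡⟨ cong (rowSum k cs + Φ t Q +_) (enqueue-growth k index deficits) ⟩
    rowSum k cs + Φ t Q + (k * y ∸ x + (suc k + suc k * y))
  ∎)
  where
  open ≡-Reasoning
  open Invariant inv
  k = suc k′
  cs′ = placeTop t cs
  Q = queue k cs
  D = deficitSum Q
  pos = m+n≡o⇒n<o⇒0<m empties y<n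
  perm = queue-placeTop k′ t cs pos
  invariant′ : Invariant k n (suc t) x (suc y) cs′
  invariant′ = record
    { index = cong suc (trans index (sym (+-suc x y)))
    ; empties = trans (+-suc _ y) (trans (cong (_+ y) (emptyColumns-placeTop t cs pos)) empties)
    ; deficits = trans (cong (_+ x) (sum-map-↭ deficit perm))
                       (trans (+-assoc k D x) (trans (cong (k +_) deficits) (sym (*-suc k y))))
    ; earlier = All-resp-↭ (↭-sym perm) (n<1+n t ∷ All.map m<n⇒m<1+n earlier)
    ; distinct = Distinct-resp-↭ (↭-sym perm) (All.map >⇒≢ earlier ∷ distinct)
    }

fillRun-invariant : ∀ {k′ n t x y cs w x′ y′} →
  Invariant (suc k′) n t x y cs → Feasible (suc k′) n x y w x′ y′ →
  let k = suc k′ ; cs′ = fillRun k t cs w in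
  ∃ λ t′ → Invariant k n t′ x′ y′ cs′ ×
    rowSum k cs′ + Φ t′ (queue k cs′) ≡
    rowSum k cs + Φ t (queue k cs) + northSum (λ x y → k * y ∸ x + (suc k + suc k * y)) x y w
fillRun-invariant inv done = _ , inv , sym (+-identityʳ _)
fillRun-invariant {k′} {x = x} {y} {cs} {north ∷ w} inv (up y<n _ path) with north-step inv y<n
... | inv₁ , eq₁ with fillRun-invariant inv₁ path
... | t′ , inv′ , eq′ = t′ , inv′ , trans eq′ (trans (cong (_+ N) eq₁) (+-assoc (rowSum k cs + Φ _ (queue k cs)) _ N))
  where
  k = suc k′
  N = northSum (λ x y → k * y ∸ x + (suc k + suc k * y)) x (suc y) w
fillRun-invariant {k′} {x = x} {y} {cs} {east ∷ w} inv (right x<ky path) with east-step inv x<ky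
... | inv₁ , eq₁ with fillRun-invariant inv₁ path
... | t′ , inv′ , eq′ = t′ , inv′ , trans eq′ (cong (_+ N) eq₁)
  where
  k = suc k′
  N = northSum (λ x y → k * y ∸ x + (suc k + suc k * y)) (suc x) y w

-- The tableau of a Dyck path

module Tableau (k′ n : ℕ) (1≤n : 1 ≤ n) where

  k m : ℕ
  k = suc k′
  m = k * n + 1

  start : List (List ℕ)
  start = (1 ∷ []) ∷ replicate (n ∸ 1) []

  queue-start : queue k start ≡ (1 , k) ∷ []
  queue-start = cong ((1 , k) ∷_) (queue-replicate k (n ∸ 1))

  start-invariant : Invariant k n 2 0 1 start
  start-invariant = record
    { index = refl
    ; empties = trans (cong (_+ 1) (emptyColumns-replicate (n ∸ 1))) (m∸n+n≡m 1≤n)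
    ; deficits = trans (cong (λ Q → deficitSum Q + 0) queue-start)
                       (trans (+-identityʳ (k + 0)) (trans (+-identityʳ k) (sym (*-identityʳ k))))
    ; earlier = subst (All _) (sym queue-start) (s≤s (s≤s z≤n) ∷ [])
    ; distinct = subst Distinct (sym queue-start) ([] ∷ [])
    }

  start-bottom : rowSum k start + Φ 2 (queue k start) ≡ suc k
  start-bottom = begin
      rowSum k start + Φ 2 (queue k start)
    ≡⟨ cong₂ _+_ (rowSum-replicate k (n ∸ 1)) (cong (Φ 2) queue-start) ⟩
      Φ 2 ((1 , k) ∷ [])
    ≡⟨ cong (λ d → 2 + (d + 0) + 0) (trans (delay-≥ {1} {1} k k ≤-refl) (m≥n⇒m⊓n≡n (n≤1+n k′))) ⟩
      2 + (k′ + 0) + 0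
    ≡⟨ simplify k′ ⟩
      suc k
    ∎
    where
    open ≡-Reasoning
    simplify : ∀ k′ → 2 + (k′ + 0) + 0 ≡ suc (suc k′)
    simplify = solve-∀

  -- The algorithm starts right after the first letter and never reads the last one, which is east.
  fillT≡fillRun : ∀ {ys} → Feasible k n 0 1 ys (k * n) n →
    fillT k n (north ∷ ys ++ [ east ]) ≡ map reverse (fillRun k 2 start ys)
  fillT≡fillRun {ys} path =
    trans (cong (λ l → map reverse (fillRun k 2 start (take l (ys ++ [ east ])))) length≡)
          (cong (map reverse ∘ fillRun k 2 start) (take-length-++ ys [ east ]))
    where
    rearrange : ∀ a n → a + 1 + n ≡ suc (a + n)
    rearrange = solve-∀
    length≡ : m + n ∸ 2 ≡ length ys
    length≡ = cong (_∸ 2) (trans (rearrange (k * n) n) (cong suc (sym (Feasible-length path))))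

  area≡northSum : ∀ ys → area m n (north ∷ ys ++ [ east ]) ≡ northSum (cellsInRow m n) 0 1 ys
  area≡northSum ys = begin
      cellsInRow m n 0 0 + areaFrom m n 0 1 (ys ++ [ east ])
    ≡⟨ cong₂ _+_ (trans (cellsInRow≡k*y∸x k n 0 0 1≤n) (cong (_∸ 0) (*-zeroʳ k)))
                 (areaFrom≡northSum m n 0 1 (ys ++ [ east ])) ⟩
      northSum (cellsInRow m n) 0 1 (ys ++ [ east ])
    ≡⟨ northSum-∷ʳ-east (cellsInRow m n) 0 1 ys ⟩
      northSum (cellsInRow m n) 0 1 ys
    ∎
    where open ≡-Reasoning

  top-row+area : ∀ {ys} → Feasible k n 0 1 ys (k * n) n →
    rowSum 0 (fillRun k 2 start ys) + northSum (cellsInRow m n) 0 1 ys ≡ k * (n C 2) + suc n C 2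
  top-row+area {ys} path = begin
      rowSum 0 (fillRun k 2 start ys) + A
    ≡⟨ cong (_+ A) (rowSum₀-fillRun 2 start path refl (Invariant.empties start-invariant)) ⟩
      rowSum 0 start + northSum (λ x y → suc (x + y)) 0 1 ys + A
    ≡⟨ +-assoc (rowSum 0 start) _ A ⟩
      rowSum 0 start + (northSum (λ x y → suc (x + y)) 0 1 ys + A)
    ≡⟨ cong₂ _+_ (cong suc (rowSum-replicate 0 (n ∸ 1))) (northSum-combine path index+cells) ⟩
      1 + N
    ≡⟨ rearrange k N ⟩
      N + (1 * 1 + suc k * (1 C 2))
    ≡⟨ northSum-affine 1 (suc k) path ⟩
      n * 1 + suc k * (n C 2)
    ≡⟨ rearrange′ k n (n C 2) ⟩
      k * (n C 2) + (n + n C 2)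
    ≡⟨ cong (k * (n C 2) +_) (suc-C2 n) ⟨
      k * (n C 2) + suc n C 2
    ∎
    where
    open ≡-Reasoning
    A = northSum (cellsInRow m n) 0 1 ys
    N = northSum (λ _ y → 1 + suc k * y) 0 1 ys
    index+cells : ∀ {x y} → y < n → x ≤ k * y → suc (x + y) + cellsInRow m n x y ≡ 1 + suc k * y
    index+cells {x} {y} y<n x≤ky = begin
        suc (x + y) + cellsInRow m n x y
      ≡⟨ cong (suc (x + y) +_) (cellsInRow≡k*y∸x k n x y y<n) ⟩
        suc (x + y) + (k * y ∸ x)
      ≡⟨ cong suc (trans (xy∙z≈y∙xz x y (k * y ∸ x)) (cong (y +_) (m+[n∸m]≡n x≤ky))) ⟩
        1 + suc k * y
      ∎
    rearrange : ∀ k N → 1 + N ≡ N + (1 * 1 + suc k * 0)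
    rearrange = solve-∀
    rearrange′ : ∀ k n c → n * 1 + suc k * c ≡ k * c + (n + c)
    rearrange′ = solve-∀

  bottom-row≡area+ : ∀ {ys} → Feasible k n 0 1 ys (k * n) n →
    rowSum k (fillRun k 2 start ys) ≡ northSum (cellsInRow m n) 0 1 ys + suc k * (suc n C 2)
  bottom-row≡area+ {ys} path with fillRun-invariant start-invariant path
  ... | t′ , invariant , eq = begin
      rowSum k fin
    ≡⟨ trans (cong (λ Q → rowSum k fin + Φ t′ Q) finished) (+-identityʳ _) ⟨
      rowSum k fin + Φ t′ (queue k fin)
    ≡⟨ eq ⟩
      rowSum k start + Φ 2 (queue k start) + B
    ≡⟨ cong₂ _+_ start-bottom (sym (northSum-combine path cells+g)) ⟩
      suc k + (A + G)
    ≡⟨ rearrange k A G ⟩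
      A + (G + (1 * suc k + suc k * (1 C 2)))
    ≡⟨ cong (A +_) (northSum-affine (suc k) (suc k) path) ⟩
      A + (n * suc k + suc k * (n C 2))
    ≡⟨ cong (A +_) (trans (factor (suc k) n (n C 2)) (cong (suc k *_) (sym (suc-C2 n)))) ⟩
      A + suc k * (suc n C 2)
    ∎
    where
    open ≡-Reasoning
    fin = fillRun k 2 start ys
    A = northSum (cellsInRow m n) 0 1 ys
    B = northSum (λ x y → k * y ∸ x + (suc k + suc k * y)) 0 1 ys
    G = northSum (λ _ y → suc k + suc k * y) 0 1 ys
    finished : queue k fin ≡ []
    finished = deficitSum≡0⇒[] (All.map proj₁ (queue-bounded k fin))
                               (+-cancelʳ-≡ (k * n) _ 0 (Invariant.deficits invariant))
    cells+g : ∀ {x y} → y < n → x ≤ k * y → cellsInRow m n x y + (suc k + suc k * y) ≡ k * y ∸ x + (suc k + suc k * y)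
    cells+g {x} {y} y<n _ = cong (_+ (suc k + suc k * y)) (cellsInRow≡k*y∸x k n x y y<n)
    rearrange : ∀ k A G → suc k + (A + G) ≡ A + (G + (1 * suc k + suc k * 0))
    rearrange = solve-∀
    factor : ∀ k n c → n * k + k * c ≡ k * (n + c)
    factor = solve-∀

open import Data.Integer using (+_; _-_)
import Data.Integer as ℤ
import Data.Integer.Tactic.RingSolver as ℤ-Solver

ℤ-transpose : ∀ {a b c d} → a + b ≡ c + d → + c - + b ≡ + a - + d
ℤ-transpose {a} {b} {c} {d} eq = begin
    + c - + b
  ≡⟨ add-sub (+ c) (+ b) (+ d) ⟩
    + (c + d) - + d - + b
  ≡⟨ cong (λ z → + z - + d - + b) eq ⟨
    + (a + b) - + d - + b
  ≡⟨ sub-add (+ a) (+ b) (+ d) ⟩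
    + a - + d
  ∎
  where
  open ≡-Reasoning
  add-sub : ∀ c b d → c - b ≡ c ℤ.+ d - d - b
  add-sub = ℤ-Solver.solve-∀
  sub-add : ∀ a b d → a ℤ.+ b - d - b ≡ a - d
  sub-add = ℤ-Solver.solve-∀

ℤ-cancel : ∀ {a b c} → a + b ≡ c → + a ≡ + c - + b
ℤ-cancel {a} {b} eq = trans (sym (cancel (+ a) (+ b))) (cong (λ z → + z - + b) eq)
  where
  cancel : ∀ a b → a ℤ.+ b - b ≡ a
  cancel = ℤ-Solver.solve-∀

proposition4p6 : (k n : ℕ) → 1 ≤ k → 1 ≤ n → (D : List Step) → IsDyck (k * n + 1) n D →
    (coarea k n D ≡ + sum (topRow k n D) - + (suc n C 2))
    × (+ area (k * n + 1) n D ≡ + sum (bottomRow k n D) - + (suc k * (suc n C 2)))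
proposition4p6 (suc k′) n _ 1≤n D dyck with dyck-shape (suc k′) n 1≤n dyck
... | ys , refl , path =
  ℤ-transpose {b = area m n D} {c = k * (n C 2)} (trans (cong₂ _+_ (row≡ 0) (area≡northSum ys)) (top-row+area path)) ,
  ℤ-cancel (sym (trans (row≡ k) (trans (bottom-row≡area+ path) (cong (_+ _) (sym (area≡northSum ys))))))
  where
  open Tableau k′ n 1≤n
  row≡ : ∀ r → sum (rowOf r (fillT k n D)) ≡ rowSum r (fillRun k 2 start ys)
  row≡ r = cong (sum ∘ rowOf r) (fillT≡fillRun path)
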